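{- Let $(G,(a,b),\bar v,\mathcal L)$ be a thread block with $\bar v=v_1,\ldots,v_n$. For $1\le i\le j\le n$ let $v_i,\ldots,v_j$ be an $\mathcal L$-constant interval of $\bar v$. For a permutation $\pi(v_i,\ldots,v_j)$ of $v_i,\ldots,v_j$, let $\bar u=u_1,\ldots,u_n$ be the ordering of $V(G)$ obtained by replacing the interval $v_i,\ldots,v_j$ in $\bar v$ by $\pi(v_i,\ldots,v_j)$. Then $(G,(u_1,u_n),\bar u,\mathcal L)$ is a thread block as well.
   Context: Graphs are finite, simple, undirected. A thread block is a tuple $(G,(a,b),\bar v,\mathcal L)$ consisting of a graph $G$, an edge $\{a,b\}\in E(G)$ (the thread edge), an ordering $\bar v=v_1,\ldots,v_n$ of $V(G)$ with $v_1=a$ and $v_n=b$, and a labeling $\mathcal L\colon V(G)\to\{\{L\},\{R\},\{L,R\}\}$ such that $\mathcal L(v_1)=\{R\}$, $\mathcal L(v_n)=\{L\}$, and for all $1\le i<j\le n$: $\{v_i,v_j\}\in E(G)$ if and only if $R\in\mathcal L(v_i)$ and $L\in\mathcal L(v_j)$. An interval of $\bar v$ is a contiguous subsequence $v_i,\ldots,v_j$; it is $\mathcal L$-constant if $\mathcal L(v_\ell)=\mathcal L(v_i)$ for all $\ell\in\{i,\ldots,j\}$. -}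

module Defs where

open import Level using (0ℓ)
open import Data.Nat using (ℕ; suc)
open import Data.Fin using (Fin; zero; fromℕ; _<_; _≤_)
open import Data.Product using (_×_)
open import Relation.Binary.PropositionalEquality using (_≡_)
open import Relation.Nullary using (¬_)
open import Function.Bundles using (_⇔_)
open import Function.Definitions using (Bijective)

record Graph (N : ℕ) : Set₁ where
  field
    Adj     : Fin N → Fin N → Set
    symm    : ∀ {x y} → Adj x y → Adj y x
    irrefl  : ∀ {x} → ¬ Adj x x

data Label : Set where
  onlyL onlyR both : Label

data HasL : Label → Set where
  L-onlyL : HasL onlyL
  L-both  : HasL both

data HasR : Label → Set where
  R-onlyR : HasR onlyR
  R-both  : HasR both

-- An ordering v_1..v_n of V(G) = Fin n, given as a bijection from positions
-- (Fin n, position 0 = v_1) to vertices.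
IsOrdering : ∀ {n} → (Fin n → Fin n) → Set
IsOrdering v = Bijective _≡_ _≡_ v

-- Thread block (G,(a,b),v,𝓛) with n = suc k vertices; v_1 = v zero, v_n = v (fromℕ k).
record ThreadBlock {k : ℕ} (G : Graph (suc k)) (a b : Fin (suc k))
                   (v : Fin (suc k) → Fin (suc k)) (𝓛 : Fin (suc k) → Label) : Set where
  open Graph G
  field
    edge     : Adj a b
    ordering : IsOrdering v
    first    : v zero ≡ a
    last     : v (fromℕ k) ≡ b
    lab-first : 𝓛 (v zero) ≡ onlyR
    lab-last  : 𝓛 (v (fromℕ k)) ≡ onlyL
    adj-iff  : ∀ (i j : Fin (suc k)) → i < j →
               Adj (v i) (v j) ⇔ (HasR (𝓛 (v i)) × HasL (𝓛 (v j)))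

LConstant : ∀ {n} → (Fin n → Fin n) → (Fin n → Label) → Fin n → Fin n → Set
LConstant v 𝓛 i j = ∀ ℓ → i ≤ ℓ → ℓ ≤ j → 𝓛 (v ℓ) ≡ 𝓛 (v i)

-- π is a permutation of positions fixing every position outside [i, j]
-- (so it permutes the interval i..j among itself).
IntervalPerm : ∀ {n} → Fin n → Fin n → (Fin n → Fin n) → Set
IntervalPerm {n} i j π =
  Bijective _≡_ _≡_ π × (∀ ℓ → (ℓ < i) → π ℓ ≡ ℓ) × (∀ ℓ → (j < ℓ) → π ℓ ≡ ℓ)

-- Positions outside [i, j] keep their vertex, and inside [i, j] all vertices share one label, so
-- the new ordering has the same label at every position. A pair of positions whose relative order
-- changes lies entirely inside [i, j]; for such a pair the two labels coincide, and the adjacency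
-- condition is symmetric in the pair, so it is unaffected by the swap.
module Submission where

open import Defs
open import Data.Nat using (ℕ; suc; z<s)
open import Data.Fin using (Fin; zero; fromℕ; _≤_; _<_)
open import Data.Fin.Properties using (_≤?_; _<?_; <⇒≢; <-cmp)
import Data.Nat.Properties as ℕ
open import Data.Product using (_×_; _,_; proj₁; proj₂)
open import Function using (_∘_)
open import Function.Bundles using (_⇔_; mk⇔; Equivalence)
open import Function.Construct.Composition using (bijective)
open import Relation.Binary using (tri<; tri≈; tri>)
open import Relation.Binary.PropositionalEquality using (_≡_; _≢_; refl; sym; trans; cong; subst)
open import Relation.Nullary using (yes; no; contradiction)

module IntervalPermutation {n : ℕ} {i j : Fin n} {π : Fin n → Fin n}
                           (perm : IntervalPerm i j π) where

  π-injective : ∀ {p q : Fin n} → π p ≡ π q → p ≡ q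
  π-injective = proj₁ (proj₁ perm)

  π-fixes-left : ∀ ℓ → ℓ < i → π ℓ ≡ ℓ
  π-fixes-left = proj₁ (proj₂ perm)

  π-fixes-right : ∀ ℓ → j < ℓ → π ℓ ≡ ℓ
  π-fixes-right = proj₂ (proj₂ perm)

  -- If π ℓ left [i, j], then π would fix π ℓ, so injectivity would give π ℓ ≡ ℓ.
  π-preserves-≥ : ∀ {ℓ} → i ≤ ℓ → i ≤ π ℓ
  π-preserves-≥ {ℓ} i≤ℓ with π ℓ <? i
  ... | yes πℓ<i = contradiction (subst (_< i) (π-injective (π-fixes-left (π ℓ) πℓ<i)) πℓ<i)
                                 (ℕ.≤⇒≯ i≤ℓ)
  ... | no πℓ≮i = ℕ.≮⇒≥ πℓ≮i

  π-preserves-≤ : ∀ {ℓ} → ℓ ≤ j → π ℓ ≤ j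
  π-preserves-≤ {ℓ} ℓ≤j with j <? π ℓ
  ... | yes j<πℓ = contradiction (subst (j <_) (π-injective (π-fixes-right (π ℓ) j<πℓ)) j<πℓ)
                                 (ℕ.≤⇒≯ ℓ≤j)
  ... | no j≮πℓ = ℕ.≮⇒≥ j≮πℓ

  <-π-of-left : ∀ {p q : Fin n} → p < i → p < q → p < π q
  <-π-of-left {p} {q} p<i p<q with q <? i
  ... | yes q<i = subst (p <_) (sym (π-fixes-left q q<i)) p<q
  ... | no q≮i = ℕ.<-≤-trans p<i (π-preserves-≥ (ℕ.≮⇒≥ q≮i))

  π-<-of-right : ∀ {p q : Fin n} → j < q → p < q → π p < q
  π-<-of-right {p} {q} j<q p<q with j <? p
  ... | yes j<p = subst (_< q) (sym (π-fixes-right p j<p)) p<q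
  ... | no j≮p = ℕ.≤-<-trans (π-preserves-≤ (ℕ.≮⇒≥ j≮p)) j<q

  π-monotone-from-left : ∀ {p q : Fin n} → p < i → p < q → π p < π q
  π-monotone-from-left {p} p<i p<q =
    subst (_< _) (sym (π-fixes-left p p<i)) (<-π-of-left p<i p<q)

  π-monotone-to-right : ∀ {p q : Fin n} → j < q → p < q → π p < π q
  π-monotone-to-right {q = q} j<q p<q =
    subst (_ <_) (sym (π-fixes-right q j<q)) (π-<-of-right j<q p<q)

  module _ (v : Fin n → Fin n) (𝓛 : Fin n → Label) (constant : LConstant v 𝓛 i j) where

    label-inside : ∀ {ℓ} → i ≤ ℓ → ℓ ≤ j → 𝓛 (v (π ℓ)) ≡ 𝓛 (v i)
    label-inside i≤ℓ ℓ≤j = constant _ (π-preserves-≥ i≤ℓ) (π-preserves-≤ ℓ≤j)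

    label-preserved : ∀ ℓ → 𝓛 (v (π ℓ)) ≡ 𝓛 (v ℓ)
    label-preserved ℓ with ℓ <? i | j <? ℓ
    ... | yes ℓ<i | _ = cong (𝓛 ∘ v) (π-fixes-left ℓ ℓ<i)
    ... | no _ | yes j<ℓ = cong (𝓛 ∘ v) (π-fixes-right ℓ j<ℓ)
    ... | no ℓ≮i | no j≮ℓ =
      trans (label-inside (ℕ.≮⇒≥ ℓ≮i) (ℕ.≮⇒≥ j≮ℓ)) (sym (constant ℓ (ℕ.≮⇒≥ ℓ≮i) (ℕ.≮⇒≥ j≮ℓ)))

    label-inside-equal : ∀ {p q} → i ≤ p → p ≤ q → q ≤ j → 𝓛 (v (π p)) ≡ 𝓛 (v (π q))
    label-inside-equal i≤p p≤q q≤j =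
      trans (label-inside i≤p (ℕ.≤-trans p≤q q≤j)) (sym (label-inside (ℕ.≤-trans i≤p p≤q) q≤j))

module _ {k : ℕ} {G : Graph (suc k)} {a b : Fin (suc k)} {v : Fin (suc k) → Fin (suc k)}
         {𝓛 : Fin (suc k) → Label} (T : ThreadBlock G a b v 𝓛) where
  open Graph G
  open ThreadBlock T

  AdjacencyLaw : Fin (suc k) → Fin (suc k) → Set
  AdjacencyLaw p q = Adj (v p) (v q) ⇔ (HasR (𝓛 (v p)) × HasL (𝓛 (v q)))

  adjacencyLaw-swap : ∀ {p q : Fin (suc k)} → 𝓛 (v p) ≡ 𝓛 (v q) → AdjacencyLaw q p → AdjacencyLaw p q
  adjacencyLaw-swap {p} {q} same law = mk⇔
    (λ pq → let r , l = Equivalence.to law (symm pq) in subst HasR (sym same) r , subst HasL same l)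
    (λ (r , l) → symm (Equivalence.from law (subst HasR same r , subst HasL (sym same) l)))

  adjacencyLaw-sameLabel : ∀ {p q : Fin (suc k)} → p ≢ q → 𝓛 (v p) ≡ 𝓛 (v q) → AdjacencyLaw p q
  adjacencyLaw-sameLabel {p} {q} p≢q same with <-cmp p q
  ... | tri< p<q _ _ = adj-iff p q p<q
  ... | tri≈ _ p≡q _ = contradiction p≡q p≢q
  ... | tri> _ _ q<p = adjacencyLaw-swap same (adj-iff q p q<p)

-- With a single vertex the thread edge would be a loop.
threadBlock-nontrivial : ∀ {k} {G : Graph (suc k)} {a b v 𝓛} → ThreadBlock {k} G a b v 𝓛 → zero {n = k} < fromℕ k
threadBlock-nontrivial {suc _} _ = z<s
threadBlock-nontrivial {0} {G} {b = b} T =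
  contradiction (subst (λ x → Adj x b) (trans (sym first) last) edge) irrefl
  where
  open Graph G
  open ThreadBlock T

lemma9 : ∀ {k : ℕ} (G : Graph (suc k)) (a b : Fin (suc k)) (v : Fin (suc k) → Fin (suc k)) (𝓛 : Fin (suc k) → Label) →
    ThreadBlock G a b v 𝓛 →
    (i j : Fin (suc k)) → i ≤ j → LConstant v 𝓛 i j →
    (π : Fin (suc k) → Fin (suc k)) → IntervalPerm i j π →
    ThreadBlock G ((v ∘ π) zero) ((v ∘ π) (fromℕ k)) (v ∘ π) 𝓛
lemma9 {k} G a b v 𝓛 T i j _ constant π perm = record
  { edge = Equivalence.from (adjacency zero (fromℕ k) (threadBlock-nontrivial T))
             (subst HasR (sym labelFirst) R-onlyR , subst HasL (sym labelLast) L-onlyL)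
  ; ordering = bijective _≡_ _≡_ _≡_ (proj₁ perm) (ThreadBlock.ordering T)
  ; first = refl
  ; last = refl
  ; lab-first = labelFirst
  ; lab-last = labelLast
  ; adj-iff = adjacency
  }
  where
  open IntervalPermutation perm
  labelFirst : 𝓛 (v (π zero)) ≡ onlyR
  labelFirst = trans (label-preserved v 𝓛 constant zero) (ThreadBlock.lab-first T)
  labelLast : 𝓛 (v (π (fromℕ k))) ≡ onlyL
  labelLast = trans (label-preserved v 𝓛 constant (fromℕ k)) (ThreadBlock.lab-last T)

  adjacency : ∀ p q → p < q → AdjacencyLaw T (π p) (π q)
  adjacency p q p<q with i ≤? p | q ≤? j
  ... | yes i≤p | yes q≤j =
    adjacencyLaw-sameLabel T (<⇒≢ p<q ∘ π-injective)
      (label-inside-equal v 𝓛 constant i≤p (ℕ.<⇒≤ p<q) q≤j)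
  ... | no i≰p | _ = ThreadBlock.adj-iff T _ _ (π-monotone-from-left (ℕ.≰⇒> i≰p) p<q)
  ... | yes _ | no q≰j = ThreadBlock.adj-iff T _ _ (π-monotone-to-right (ℕ.≰⇒> q≰j) p<q)
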